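{- There is a set $L$ of $(1-o(1))\,0.62\,q^3$ lines in $\mathbb{F}_q^3$ such that $|P(L)|<0.43\,q^3$.
   Context: $\mathbb{F}_q$ is the finite field with $q$ elements ($q$ a prime power, thought of as large); lines are one-dimensional affine subspaces of $\mathbb{F}_q^3$. For a set $L$ of lines, $P(L)=\bigcup_{\ell\in L}\ell$. Here $o(1)$ denotes a quantity tending to $0$ as $q\to\infty$. -}

module Defs where

open import Level using (0ℓ)
open import Data.Nat using (ℕ)
open import Data.Fin using (Fin)
open import Data.Product using (_×_; _,_; ∃; Σ)
open import Data.List using (List)
open import Data.List.Membership.Propositional using (_∈_)
open import Data.List.Relation.Unary.All using (All)
open import Data.List.Relation.Unary.AllPairs using (AllPairs)
open import Relation.Binary.PropositionalEquality using (_≡_)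
open import Relation.Nullary using (¬_)
open import Algebra.Structures using (IsCommutativeRing)
open import Function.Bundles using (_↔_)

-- A finite field with exactly q elements (equality is propositional equality
-- on the carrier).  Any such field is (isomorphic to) F_q.
record FiniteField (q : ℕ) : Set₁ where
  field
    F   : Set
    _+_ : F → F → F
    _*_ : F → F → F
    -_  : F → F
    0#  : F
    1#  : F
    isCommutativeRing : IsCommutativeRing _≡_ _+_ _*_ -_ 0# 1#
    0≢1 : ¬ (0# ≡ 1#)
    inverse : ∀ x → ¬ (x ≡ 0#) → ∃ λ y → x * y ≡ 1#
    card : F ↔ Fin q

module _ {q : ℕ} (K : FiniteField q) where
  open FiniteField K

  Point : Set
  Point = F × F × F

  origin : Point
  origin = (0# , 0# , 0#)

  record Line : Set where
    constructor line
    field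
      base : Point
      dir  : Point
      dir≢0 : ¬ (dir ≡ origin)

  _onLine_ : Point → Line → Set
  (x , y , z) onLine line (a₁ , a₂ , a₃) (d₁ , d₂ , d₃) _ =
    ∃ λ t → (x ≡ a₁ + (t * d₁)) × (y ≡ a₂ + (t * d₂)) × (z ≡ a₃ + (t * d₃))

  SameLine : Line → Line → Set
  SameLine ℓ ℓ′ = ∀ p → (p onLine ℓ → p onLine ℓ′) × (p onLine ℓ′ → p onLine ℓ)

  -- L is a list of pairwise distinct lines (so length L = |L| as a set of lines)
  DistinctLines : List Line → Set
  DistinctLines L = AllPairs (λ ℓ ℓ′ → ¬ SameLine ℓ ℓ′) L

  -- Ps is a repetition-free enumeration of P(L) = ⋃_{ℓ ∈ L} ℓ
  -- (so length Ps = |P(L)|)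
  Enumerates-P : List Line → List Point → Set
  Enumerates-P L Ps =
    AllPairs (λ p p′ → ¬ (p ≡ p′)) Ps
    × (∀ p → p ∈ Ps → ∃ λ ℓ → (ℓ ∈ L) × (p onLine ℓ))
    × (∀ p ℓ → ℓ ∈ L → p onLine ℓ → p ∈ Ps)

module Submission where

-- Choose k = ⌈0.62 q⌉ distinct elements a ∈ F_q and the planes Π_a : y = a x + a², each containing
-- the q² lines (t, a² + a t, c + e t); these k q² lines are distinct and their union is the union
-- of the planes.  Π_a and Π_b agree above x = −(a + b), and these x are distinct for distinct b,
-- so if m planes follow Π_a, at most q (q − m) of its points lie on none of them.  Hence
-- |P(L)| ≤ q Σ_{i<k} (q − i) = q (k q − k (k − 1) / 2) ≈ (0.62 − 0.62² / 2) q³ < 0.43 q³.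

open import Defs
open import Level using (0ℓ)
open import Data.Nat as ℕ using (ℕ; zero; suc; _≤_; _<_; _^_; z≤n; s≤s)
import Data.Nat.Properties as ℕ
open import Data.Fin.Properties using (inj⇒≟)
open import Data.Product using (_×_; _,_; ∃; Σ; proj₁; proj₂)
open import Data.Empty using (⊥-elim)
open import Data.List using (List; []; _∷_; _++_; length; map; filter; take; allFin; cartesianProduct)
open import Data.List.Properties using (length-map; length-++; length-take; length-tabulate; length-removeAt′)
open import Data.List.Relation.Unary.Any using (Any; here; there; index; any?)
import Data.List.Relation.Unary.All as All
open import Data.List.Relation.Unary.AllPairs using (_∷_)
import Data.List.Relation.Unary.AllPairs as AllPairs
import Data.List.Relation.Unary.AllPairs.Properties as AllPairs
open import Data.List.Relation.Unary.Unique.Propositional using (Unique)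
import Data.List.Relation.Unary.Unique.Propositional.Properties as Unique
open import Data.List.Relation.Binary.Subset.Propositional using (_⊆_)
open import Data.List.Membership.Propositional using (_∈_; _─_; lose; find)
open import Data.List.Membership.Propositional.Properties
  using (∈-map⁺; ∈-map⁻; ∈-filter⁺; ∈-filter⁻; ∈-++⁺ˡ; ∈-++⁺ʳ; ∈-allFin;
         ∈-cartesianProduct⁺; ∈-cartesianProduct⁻)
open import Relation.Binary.PropositionalEquality
  using (_≡_; _≢_; refl; sym; trans; cong; cong₂; subst; module ≡-Reasoning)
open import Relation.Binary.Definitions using (DecidableEquality)
open import Relation.Nullary using (Dec; yes; no)
open import Algebra.Bundles using (CommutativeRing)
open import Function.Bundles using (Inverse)
open import Function.Properties.Inverse using (↔⇒↣)

module _ {A : Set} where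

  ∈-─ : ∀ {x y} {ys : List A} (x∈ys : x ∈ ys) → y ∈ ys → y ≢ x → y ∈ ys ─ x∈ys
  ∈-─ (here refl)  (here refl)  y≢x = ⊥-elim (y≢x refl)
  ∈-─ (here _)     (there y∈ys) _   = y∈ys
  ∈-─ (there _)    (here y≡)    _   = here y≡
  ∈-─ (there x∈ys) (there y∈ys) y≢x = there (∈-─ x∈ys y∈ys y≢x)

  Unique⇒length≤ : ∀ {xs ys : List A} → Unique xs → xs ⊆ ys → length xs ≤ length ys
  Unique⇒length≤ {[]}          _            _     = z≤n
  Unique⇒length≤ {x ∷ xs} {ys} (x∉xs ∷ xs!) xs⊆ys =
    subst (suc (length xs) ≤_) (sym (length-removeAt′ ys (index x∈ys)))
      (s≤s (Unique⇒length≤ xs! λ y∈xs →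
        ∈-─ x∈ys (xs⊆ys (there y∈xs)) λ y≡x → All.lookup x∉xs y∈xs (sym y≡x)))
    where x∈ys = xs⊆ys (here refl)

length-cartesianProduct : ∀ {A B : Set} (xs : List A) (ys : List B) →
                          length (cartesianProduct xs ys) ≡ length xs ℕ.* length ys
length-cartesianProduct []       ys = refl
length-cartesianProduct (x ∷ xs) ys = begin
  length (map (x ,_) ys ++ cartesianProduct xs ys)
    ≡⟨ length-++ (map (x ,_) ys) ⟩
  length (map (x ,_) ys) ℕ.+ length (cartesianProduct xs ys)
    ≡⟨ cong₂ ℕ._+_ (length-map (x ,_) ys) (length-cartesianProduct xs ys) ⟩
  length ys ℕ.+ length xs ℕ.* length ys ∎
  where open ≡-Reasoning

fallingSum : ℕ → ℕ → ℕ
fallingSum r zero    = 0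
fallingSum r (suc m) = r ℕ.∸ m ℕ.+ fallingSum r m

module PlaneAlgebra {r ℓ} (R : CommutativeRing r ℓ) where

  open CommutativeRing R hiding (refl; sym; trans)
  open import Algebra.Properties.Ring ring using (+-cancelˡ; -‿injective; -‿+-comm; -‿distribˡ-*)
  open import Relation.Binary.Reasoning.Setoid setoid

  Π : Carrier → Carrier → Carrier
  Π a x = a * a + x * a

  a-[a+b]≈-b : ∀ a b → a + - (a + b) ≈ - b
  a-[a+b]≈-b a b = begin
    a + - (a + b)       ≈⟨ +-congˡ (-‿+-comm a b) ⟨
    a + (- a + - b)     ≈⟨ +-assoc a (- a) (- b) ⟨
    a + - a + - b       ≈⟨ +-congʳ (-‿inverseʳ a) ⟩
    0# + - b            ≈⟨ +-identityˡ (- b) ⟩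
    - b                 ∎

  Π-meet : ∀ a b → Π a (- (a + b)) ≈ Π b (- (a + b))
  Π-meet a b = begin
    a * a + x * a       ≈⟨ distribʳ a a x ⟨
    (a + x) * a         ≈⟨ *-congʳ (a-[a+b]≈-b a b) ⟩
    - b * a             ≈⟨ -‿distribˡ-* b a ⟨
    - (b * a)           ≈⟨ -‿cong (*-comm b a) ⟩
    - (a * b)           ≈⟨ -‿distribˡ-* a b ⟩
    - a * b             ≈⟨ *-congʳ (a-[a+b]≈-b b a) ⟨
    (b + - (b + a)) * b ≈⟨ *-congʳ (+-congˡ (-‿cong (+-comm b a))) ⟩
    (b + x) * b         ≈⟨ distribʳ b b x ⟩
    b * b + x * b       ∎
    where x = - (a + b)

  meet-injective : ∀ a {b b′} → - (a + b) ≈ - (a + b′) → b ≈ b′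
  meet-injective a eq = +-cancelˡ a _ _ (-‿injective eq)

  affine-injective : ∀ {u v u′ v′} → (∀ x → u + x * v ≈ u′ + x * v′) → u ≈ u′ × v ≈ v′
  affine-injective {u} {v} {u′} {v′} agree = u≈u′ , v≈v′
    where
    at0 : ∀ u v → u + 0# * v ≈ u
    at0 u v = begin
      u + 0# * v        ≈⟨ +-congˡ (zeroˡ v) ⟩
      u + 0#            ≈⟨ +-identityʳ u ⟩
      u                 ∎
    u≈u′ : u ≈ u′
    u≈u′ = begin
      u                 ≈⟨ at0 u v ⟨
      u + 0# * v        ≈⟨ agree 0# ⟩
      u′ + 0# * v′      ≈⟨ at0 u′ v′ ⟩
      u′                ∎
    v≈v′ : v ≈ v′
    v≈v′ = begin
      v                 ≈⟨ *-identityˡ v ⟨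
      1# * v            ≈⟨ +-cancelˡ u _ _ (begin
                             u + 1# * v     ≈⟨ agree 1# ⟩
                             u′ + 1# * v′   ≈⟨ +-congʳ u≈u′ ⟨
                             u + 1# * v′    ∎) ⟩
      1# * v′           ≈⟨ *-identityˡ v′ ⟩
      v′                ∎

module PlaneConstruction {q : ℕ} (K : FiniteField q) where

  open FiniteField K using (F; 0#; 1#; 0≢1; card)

  ring : CommutativeRing 0ℓ 0ℓ
  ring = record { isCommutativeRing = FiniteField.isCommutativeRing K }

  open CommutativeRing ring using (_+_; _*_; -_; +-identityˡ; +-identityʳ; *-identityʳ; zeroʳ)
  open PlaneAlgebra ring
  open Inverse card using (to; from; strictlyInverseˡ; strictlyInverseʳ)

  _≟_ : DecidableEquality F
  _≟_ = inj⇒≟ (↔⇒↣ card)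

  open import Data.List.Membership.DecPropositional _≟_ using (_∈?_; _∉?_)

  elements : List F
  elements = map from (allFin q)

  elements-unique : Unique elements
  elements-unique = Unique.map⁺ from-injective (Unique.allFin⁺ q)
    where
    from-injective : ∀ {i j} → from i ≡ from j → i ≡ j
    from-injective {i} {j} eq = trans (sym (strictlyInverseˡ i)) (trans (cong to eq) (strictlyInverseˡ j))

  ∈-elements : ∀ x → x ∈ elements
  ∈-elements x = subst (_∈ elements) (strictlyInverseʳ x) (∈-map⁺ from (∈-allFin (to x)))

  length-elements : length elements ≡ q
  length-elements = trans (length-map from (allFin q)) (length-tabulate (λ i → i))

  length-take-elements : ∀ {k} → k ≤ q → length (take k elements) ≡ k
  length-take-elements {k} k≤q =
    trans (length-take k elements) (trans (cong (k ℕ.⊓_) length-elements) (ℕ.m≤n⇒m⊓n≡m k≤q))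

  planeLine : F × F × F → Line K
  planeLine (a , c , e) = line (0# , a * a , c) (1# , a , e) λ d≡0 → 0≢1 (sym (cong proj₁ d≡0))

  onPlaneLine⁺ : ∀ {a c e x y z} → y ≡ Π a x → z ≡ c + x * e → _onLine_ K (x , y , z) (planeLine (a , c , e))
  onPlaneLine⁺ {x = x} y≡ z≡ = x , sym (trans (+-identityˡ (x * 1#)) (*-identityʳ x)) , y≡ , z≡

  onPlaneLine⁻ : ∀ {a c e x y z} → _onLine_ K (x , y , z) (planeLine (a , c , e)) → y ≡ Π a x × z ≡ c + x * e
  onPlaneLine⁻ (t , x≡ , y≡ , z≡) with trans x≡ (trans (+-identityˡ (t * 1#)) (*-identityʳ t))
  ... | refl = y≡ , z≡

  sameLine⇒sameGraph : ∀ {a c e a′ c′ e′} → SameLine K (planeLine (a , c , e)) (planeLine (a′ , c′ , e′)) →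
                       ∀ x → Π a x ≡ Π a′ x × c + x * e ≡ c′ + x * e′
  sameLine⇒sameGraph same x = onPlaneLine⁻ (proj₁ (same _) (onPlaneLine⁺ refl refl))

  planeLine-injective : ∀ {t t′} → SameLine K (planeLine t) (planeLine t′) → t ≡ t′
  planeLine-injective same
    with _ , refl ← affine-injective (λ x → proj₁ (sameLine⇒sameGraph same x))
       | refl , refl ← affine-injective (λ x → proj₂ (sameLine⇒sameGraph same x)) = refl

  allPoints : List (Point K)
  allPoints = cartesianProduct elements (cartesianProduct elements elements)

  ∈-allPoints : ∀ p → p ∈ allPoints
  ∈-allPoints (x , y , z) = ∈-cartesianProduct⁺ (∈-elements x) (∈-cartesianProduct⁺ (∈-elements y) (∈-elements z))

  InPlanes : List F → Point K → Set
  InPlanes as (x , y , z) = Any (λ a → y ≡ Π a x) as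

  InPlanes? : ∀ as p → Dec (InPlanes as p)
  InPlanes? as (x , y , z) = any? (λ a → y ≟ Π a x) as

  meets : List F → F → List F
  meets as a = map (λ b → - (a + b)) as

  fresh : List F → F → List F
  fresh as a = filter (_∉? meets as a) elements

  -- By Π-meet, the points of Π a left out here lie on a plane Π b with b ∈ as.
  newPoints : List F → F → List (Point K)
  newPoints as a = map (λ (x , z) → x , Π a x , z) (cartesianProduct (fresh as a) elements)

  sweep : List F → List (Point K)
  sweep []       = []
  sweep (a ∷ as) = newPoints as a ++ sweep as

  sweep-complete : ∀ as {p} → InPlanes as p → p ∈ sweep as
  sweep-complete (a ∷ as) {x , _ , z} (here refl) with x ∈? meets as a
  ... | no x∉meets =
    ∈-++⁺ˡ (∈-map⁺ _ (∈-cartesianProduct⁺ (∈-filter⁺ (_∉? meets as a) (∈-elements x) x∉meets)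
                                          (∈-elements z)))
  ... | yes x∈meets with b , b∈as , refl ← ∈-map⁻ _ x∈meets =
    ∈-++⁺ʳ (newPoints as a) (sweep-complete as (lose b∈as (Π-meet a b)))
  sweep-complete (a ∷ as) (there p∈) = ∈-++⁺ʳ (newPoints as a) (sweep-complete as p∈)

  length-fresh : ∀ as a → Unique as → length (fresh as a) ℕ.+ length as ≤ q
  length-fresh as a as! = begin
    length (fresh as a) ℕ.+ length as           ≡⟨ cong (length (fresh as a) ℕ.+_) (length-map _ as) ⟨
    length (fresh as a) ℕ.+ length (meets as a) ≡⟨ length-++ (fresh as a) ⟨
    length (fresh as a ++ meets as a)           ≤⟨ Unique⇒length≤ fresh++meets! (λ {x} _ → ∈-elements x) ⟩
    length elements                             ≡⟨ length-elements ⟩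
    q                                           ∎
    where
    open ℕ.≤-Reasoning
    fresh++meets! : Unique (fresh as a ++ meets as a)
    fresh++meets! = Unique.++⁺ (Unique.filter⁺ (_∉? meets as a) elements-unique)
                               (Unique.map⁺ (meet-injective a) as!)
                               (λ (x∈fresh , x∈meets) →
                                  proj₂ (∈-filter⁻ (_∉? meets as a) {xs = elements} x∈fresh) x∈meets)

  length-newPoints : ∀ as a → Unique as → length (newPoints as a) ≤ (q ℕ.∸ length as) ℕ.* q
  length-newPoints as a as! = begin
    length (newPoints as a)
      ≡⟨ length-map _ (cartesianProduct (fresh as a) elements) ⟩
    length (cartesianProduct (fresh as a) elements)
      ≡⟨ length-cartesianProduct (fresh as a) elements ⟩
    length (fresh as a) ℕ.* length elements
      ≤⟨ ℕ.*-mono-≤ (ℕ.m+n≤o⇒m≤o∸n (length (fresh as a)) (length-fresh as a as!)) (ℕ.≤-reflexive length-elements) ⟩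
    (q ℕ.∸ length as) ℕ.* q ∎
    where open ℕ.≤-Reasoning

  length-sweep : ∀ as → Unique as → length (sweep as) ≤ q ℕ.* fallingSum q (length as)
  length-sweep []       _         = z≤n
  length-sweep (a ∷ as) (_ ∷ as!) = begin
    length (newPoints as a ++ sweep as)
      ≡⟨ length-++ (newPoints as a) ⟩
    length (newPoints as a) ℕ.+ length (sweep as)
      ≤⟨ ℕ.+-mono-≤ (length-newPoints as a as!) (length-sweep as as!) ⟩
    (q ℕ.∸ length as) ℕ.* q ℕ.+ q ℕ.* fallingSum q (length as)
      ≡⟨ cong (ℕ._+ q ℕ.* fallingSum q (length as)) (ℕ.*-comm (q ℕ.∸ length as) q) ⟩
    q ℕ.* (q ℕ.∸ length as) ℕ.+ q ℕ.* fallingSum q (length as)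
      ≡⟨ ℕ.*-distribˡ-+ q (q ℕ.∸ length as) _ ⟨
    q ℕ.* fallingSum q (length (a ∷ as)) ∎
    where open ℕ.≤-Reasoning

  module _ (A : List F) (A! : Unique A) where

    triples : List (F × F × F)
    triples = cartesianProduct A (cartesianProduct elements elements)

    lines : List (Line K)
    lines = map planeLine triples

    lines-distinct : DistinctLines K lines
    lines-distinct = AllPairs.map⁺ (AllPairs.map (λ t≢t′ same → t≢t′ (planeLine-injective same))
      (Unique.cartesianProduct⁺ A! (Unique.cartesianProduct⁺ elements-unique elements-unique)))

    length-lines : length lines ≡ length A ℕ.* (q ℕ.* q)
    length-lines = begin
      length lines
        ≡⟨ length-map planeLine triples ⟩
      length triples
        ≡⟨ length-cartesianProduct A (cartesianProduct elements elements) ⟩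
      length A ℕ.* length (cartesianProduct elements elements)
        ≡⟨ cong (length A ℕ.*_) (length-cartesianProduct elements elements) ⟩
      length A ℕ.* (length elements ℕ.* length elements)
        ≡⟨ cong (λ n → length A ℕ.* (n ℕ.* n)) length-elements ⟩
      length A ℕ.* (q ℕ.* q) ∎
      where open ≡-Reasoning

    points : List (Point K)
    points = filter (InPlanes? A) allPoints

    points-unique : Unique points
    points-unique = Unique.filter⁺ (InPlanes? A)
      (Unique.cartesianProduct⁺ elements-unique (Unique.cartesianProduct⁺ elements-unique elements-unique))

    points-sound : ∀ p → p ∈ points → ∃ λ ℓ → ℓ ∈ lines × _onLine_ K p ℓ
    points-sound (x , y , z) p∈ with a , a∈A , y≡ ← find (proj₂ (∈-filter⁻ (InPlanes? A) {xs = allPoints} p∈)) =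
      planeLine (a , z , 0#) ,
      ∈-map⁺ planeLine (∈-cartesianProduct⁺ a∈A (∈-cartesianProduct⁺ (∈-elements z) (∈-elements 0#))) ,
      onPlaneLine⁺ y≡ (sym (trans (cong (z +_) (zeroʳ x)) (+-identityʳ z)))

    points-complete : ∀ p ℓ → ℓ ∈ lines → _onLine_ K p ℓ → p ∈ points
    points-complete (x , y , z) ℓ ℓ∈ p∈ℓ with (a , c , e) , t∈ , refl ← ∈-map⁻ planeLine ℓ∈ =
      ∈-filter⁺ (InPlanes? A) (∈-allPoints (x , y , z))
        (lose (proj₁ (∈-cartesianProduct⁻ A _ t∈)) (proj₁ (onPlaneLine⁻ p∈ℓ)))

    points-enumerate : Enumerates-P K lines points
    points-enumerate = points-unique , points-sound , points-complete

    length-points : length points ≤ q ℕ.* fallingSum q (length A)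
    length-points = ℕ.≤-trans
      (Unique⇒length≤ points-unique λ p∈ →
        sweep-complete A (proj₂ (∈-filter⁻ (InPlanes? A) {xs = allPoints} p∈)))
      (length-sweep A A!)

open import Data.Nat using (_+_; _*_; _∸_; _/_; _%_; s≤s⁻¹; >-nonZero)
open import Data.Nat.Properties
open import Data.Nat.DivMod using (m/n*n≤m; m%n<n; m≡m%n+[m/n]*n)
open import Data.Nat.Tactic.RingSolver using (solve-∀)

fallingSum-closed : ∀ {r} m → m ≤ r → 2 * fallingSum r m + m * m ≡ 2 * m * r + m
fallingSum-closed zero _ = refl
fallingSum-closed {r} (suc m) m<r = begin
  2 * (r ∸ m + fallingSum r m) + suc m * suc m
    ≡⟨ regroup (r ∸ m) (fallingSum r m) m ⟩
  2 * (r ∸ m) + (2 * fallingSum r m + m * m) + 2 * m + 1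
    ≡⟨ cong (λ v → 2 * (r ∸ m) + v + 2 * m + 1) (fallingSum-closed m (<⇒≤ m<r)) ⟩
  2 * (r ∸ m) + (2 * m * r + m) + 2 * m + 1
    ≡⟨ subst (λ v → 2 * (r ∸ m) + (2 * m * v + m) + 2 * m + 1 ≡ 2 * suc m * v + suc m)
             (m∸n+n≡m (<⇒≤ m<r)) (step (r ∸ m) m) ⟩
  2 * suc m * r + suc m ∎
  where
  open ≡-Reasoning
  regroup : ∀ w d m → 2 * (w + d) + suc m * suc m ≡ 2 * w + (2 * d + m * m) + 2 * m + 1
  regroup = solve-∀
  step : ∀ w m → 2 * w + (2 * m * (w + m) + m) + 2 * m + 1 ≡ 2 * suc m * (w + m) + suc m
  step = solve-∀

ceil62 : ℕ → ℕ
ceil62 q = (62 * q + 99) / 100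

ceil62-upper : ∀ q → 100 * ceil62 q ≤ 62 * q + 99
ceil62-upper q = subst (_≤ 62 * q + 99) (*-comm (ceil62 q) 100) (m/n*n≤m (62 * q + 99) 100)

ceil62-lower : ∀ q → 62 * q ≤ 100 * ceil62 q
ceil62-lower q = +-cancelʳ-≤ 99 (62 * q) (100 * ceil62 q) (begin
  62 * q + 99
    ≡⟨ m≡m%n+[m/n]*n (62 * q + 99) 100 ⟩
  (62 * q + 99) % 100 + ceil62 q * 100
    ≤⟨ +-mono-≤ (s≤s⁻¹ (m%n<n (62 * q + 99) 100)) (≤-reflexive (*-comm (ceil62 q) 100)) ⟩
  99 + 100 * ceil62 q
    ≡⟨ +-comm 99 _ ⟩
  100 * ceil62 q + 99 ∎)
  where open ≤-Reasoning

ceil62≤ : ∀ {q} → 3 ≤ q → ceil62 q ≤ q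
ceil62≤ {q} 3≤q = *-cancelˡ-≤ 100 (begin
  100 * ceil62 q  ≤⟨ ceil62-upper q ⟩
  62 * q + 99     ≤⟨ +-monoʳ-≤ (62 * q) (≤-trans (m≤m+n 99 15) (*-monoʳ-≤ 38 3≤q)) ⟩
  62 * q + 38 * q ≡⟨ split q ⟩
  100 * q         ∎)
  where
  open ≤-Reasoning
  split : ∀ q → 62 * q + 38 * q ≡ 100 * q
  split = solve-∀

linear-terms<44q² : ∀ {q s} → 400 ≤ q → s ≤ 99 → 76 * s * q + 6200 * q + 100 * s < 44 * (q * q)
linear-terms<44q² {q} {s} 400≤q s≤99 = begin-strict
  76 * s * q + 6200 * q + 100 * s
    ≤⟨ +-mono-≤ (+-monoˡ-≤ (6200 * q) (*-monoˡ-≤ q (*-monoʳ-≤ 76 s≤99))) (*-monoʳ-≤ 100 s≤99) ⟩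
  7524 * q + 6200 * q + 9900
    <⟨ +-monoʳ-< (7524 * q + 6200 * q) (≤-trans (m≤m+n 9901 1540499) (*-monoʳ-≤ 3876 400≤q)) ⟩
  7524 * q + 6200 * q + 3876 * q
    ≡⟨ collect q ⟩
  (44 * 400) * q
    ≤⟨ *-monoˡ-≤ q (*-monoʳ-≤ 44 400≤q) ⟩
  44 * q * q
    ≡⟨ *-assoc 44 q q ⟩
  44 * (q * q) ∎
  where
  open ≤-Reasoning
  collect : ∀ q → 7524 * q + 6200 * q + 3876 * q ≡ (44 * 400) * q
  collect = solve-∀

-- With u = 100 k this is 2 k q + k − k² < 0.86 q².
density-gap : ∀ {q u} → 400 ≤ q → 62 * q ≤ u → u ≤ 62 * q + 99 →
              200 * u * q + 100 * u < 8600 * (q * q) + u * u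
density-gap {q} 400≤q 62q≤u u≤62q+99 with s , refl ← m≤n⇒∃[o]m+o≡n 62q≤u = begin-strict
  200 * (62 * q + s) * q + 100 * (62 * q + s)
    ≡⟨ expandˡ q s ⟩
  12400 * (q * q) + 124 * s * q + (76 * s * q + 6200 * q + 100 * s)
    <⟨ +-monoʳ-< (12400 * (q * q) + 124 * s * q) (linear-terms<44q² 400≤q (+-cancelˡ-≤ (62 * q) s 99 u≤62q+99)) ⟩
  12400 * (q * q) + 124 * s * q + 44 * (q * q)
    ≤⟨ m≤m+n _ (s * s) ⟩
  12400 * (q * q) + 124 * s * q + 44 * (q * q) + s * s
    ≡⟨ expandʳ q s ⟩
  8600 * (q * q) + (62 * q + s) * (62 * q + s) ∎
  where
  open ≤-Reasoning
  expandˡ : ∀ q s → 200 * (62 * q + s) * q + 100 * (62 * q + s)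
                  ≡ 12400 * (q * q) + 124 * s * q + (76 * s * q + 6200 * q + 100 * s)
  expandˡ = solve-∀
  expandʳ : ∀ q s → 12400 * (q * q) + 124 * s * q + 44 * (q * q) + s * s
                  ≡ 8600 * (q * q) + (62 * q + s) * (62 * q + s)
  expandʳ = solve-∀

fallingSum-ceil62 : ∀ {q} → 400 ≤ q → 100 * fallingSum q (ceil62 q) < 43 * (q * q)
fallingSum-ceil62 {q} 400≤q = *-cancelˡ-< 200 _ _ (+-cancelʳ-< (u * u) _ _ (begin-strict
  200 * (100 * d) + u * u  ≡⟨ scaled ⟩
  200 * u * q + 100 * u    <⟨ density-gap 400≤q (ceil62-lower q) (ceil62-upper q) ⟩
  8600 * (q * q) + u * u   ≡⟨ cong (_+ u * u) (*-assoc 200 43 (q * q)) ⟩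
  200 * (43 * (q * q)) + u * u ∎))
  where
  open ≤-Reasoning
  k = ceil62 q
  d = fallingSum q k
  u = 100 * k
  scaleˡ : ∀ d k → 200 * (100 * d) + 100 * k * (100 * k) ≡ 10000 * (2 * d + k * k)
  scaleˡ = solve-∀
  scaleʳ : ∀ k q → 10000 * (2 * k * q + k) ≡ 200 * (100 * k) * q + 100 * (100 * k)
  scaleʳ = solve-∀
  scaled : 200 * (100 * d) + u * u ≡ 200 * u * q + 100 * u
  scaled = begin-equality
    200 * (100 * d) + u * u   ≡⟨ scaleˡ d k ⟩
    10000 * (2 * d + k * k)   ≡⟨ cong (10000 *_) (fallingSum-closed k (ceil62≤ (≤-trans (m≤m+n 3 397) 400≤q))) ⟩
    10000 * (2 * k * q + k)   ≡⟨ scaleʳ k q ⟩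
    200 * u * q + 100 * u     ∎

ceil62-lines : ∀ n q → 62 * n * q ^ 3 ≤ 100 * suc n * (ceil62 q * (q * q))
ceil62-lines n q = begin
  62 * n * q ^ 3                   ≤⟨ *-monoˡ-≤ (q ^ 3) (*-monoʳ-≤ 62 (n≤1+n n)) ⟩
  62 * suc n * q ^ 3               ≡⟨ regroupˡ (suc n) q ⟩
  suc n * (q * q) * (62 * q)       ≤⟨ *-monoʳ-≤ (suc n * (q * q)) (ceil62-lower q) ⟩
  suc n * (q * q) * (100 * ceil62 q) ≡⟨ regroupʳ (suc n) q (ceil62 q) ⟩
  100 * suc n * (ceil62 q * (q * q)) ∎
  where
  open ≤-Reasoning
  regroupˡ : ∀ m q → 62 * m * (q * (q * (q * 1))) ≡ m * (q * q) * (62 * q)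
  regroupˡ = solve-∀
  regroupʳ : ∀ m q k → m * (q * q) * (100 * k) ≡ 100 * m * (k * (q * q))
  regroupʳ = solve-∀

ceil62-points : ∀ {q P} → 400 ≤ q → P ≤ q * fallingSum q (ceil62 q) → 100 * P < 43 * q ^ 3
ceil62-points {q} {P} 400≤q P≤ = begin-strict
  100 * P                          ≤⟨ *-monoʳ-≤ 100 P≤ ⟩
  100 * (q * d)                    ≡⟨ swap q d ⟩
  q * (100 * d)                    <⟨ *-monoʳ-< q {{q≢0}} (fallingSum-ceil62 400≤q) ⟩
  q * (43 * (q * q))               ≡⟨ cube q ⟩
  43 * q ^ 3                       ∎
  where
  open ≤-Reasoning
  d = fallingSum q (ceil62 q)
  q≢0 = >-nonZero (≤-trans (s≤s z≤n) 400≤q)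
  swap : ∀ q d → 100 * (q * d) ≡ q * (100 * d)
  swap = solve-∀
  cube : ∀ q → q * (43 * (q * q)) ≡ 43 * (q * (q * (q * 1)))
  cube = solve-∀

proposition2 : (n : ℕ) → ∃ λ (Q : ℕ) → (q : ℕ) → Q ≤ q → (K : FiniteField q) →
    Σ (List (Line K)) λ L → Σ (List (Point K)) λ Ps →
      DistinctLines K L × Enumerates-P K L Ps
      × (62 * n * (q ^ 3) ≤ 100 * suc n * length L)
      × (100 * length Ps < 43 * (q ^ 3))
proposition2 n = 400 , λ q 400≤q K →
  let open PlaneConstruction K
      A  = take (ceil62 q) elements
      A! = Unique.take⁺ (ceil62 q) elements-unique
      |A| = length-take-elements (ceil62≤ (≤-trans (m≤m+n 3 397) 400≤q))
  in lines A A! , points A A! , lines-distinct A A! , points-enumerate A A!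
   , subst (λ m → 62 * n * q ^ 3 ≤ 100 * suc n * m)
           (sym (trans (length-lines A A!) (cong (_* (q * q)) |A|))) (ceil62-lines n q)
   , ceil62-points 400≤q (subst (λ m → length (points A A!) ≤ q * fallingSum q m) |A| (length-points A A!))
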